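{- Fix a constant $d$. For a graph $G=([n],E(G))$ of maximum degree at most $d$, let $\rho(G)$ be the $3$-uniform hypergraph $H=([n+dn],E(H))$ whose hyperedges are the sets $\{u,v,n+(u-1)d+j\}$ for all $u<v$ such that $\{u,v\}\in E(G)$ is the $j$-th edge incident on $u$ in a fixed global ordering of the edges. Then $\rho$ is a local and gap-preserving reduction from $3$-colorability of graphs of maximum degree at most $d$ to $3$-partiteness of $3$-uniform hypergraphs of bounded degree.
   Context: A graph is $3$-colorable if its vertices can be colored with $3$ colors so that adjacent vertices get distinct colors. A $3$-uniform hypergraph is $3$-partite if there is a map $V(H)\to\{1,2,3\}$ giving the three vertices of every hyperedge three distinct colors. In the bounded degree model with degree bound $\Delta$, the distance between two (hyper)graphs on the same vertex set with edge sets $E_1,E_2$ is $(|E_1\setminus E_2|+|E_2\setminus E_1|)/(\Delta N)$, $N$ the number of vertices, and an object is $\varepsilon$-far from a property if its distance to every object with the property exceeds $\varepsilon$. A mapping $\rho$ from objects of bounded degree to objects is a local and gap-preserving reduction from property $\mathcal P_1$ to property $\mathcal P_2$ if: $\rho$ of an $n$-vertex input has $O(n)$ vertices and maximum degree bounded by a constant depending only on the input degree bound; every incidence (adjacency-list) query to $\rho(X)$ can be answered with $O(1)$ queries to $X$; $X\in\mathcal P_1$ implies $\rho(X)\in\mathcal P_2$; and there is a constant $c>0$ such that whenever $X$ is $\varepsilon$-far from $\mathcal P_1$, $\rho(X)$ is $c\varepsilon$-far from $\mathcal P_2$. -}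

module Defs where

open import Data.Bool.Base using (Bool; true; false; _∧_; _∨_; _xor_; if_then_else_)
open import Data.Nat.Base using (ℕ; zero; suc; _+_; _*_; _≤_)
open import Data.Fin.Base using (Fin; _↑ˡ_; _↑ʳ_; splitAt; combine; remQuot) renaming (_<_ to _<ᶠ_)
open import Data.Fin.Properties using (_≟_; _<?_)
open import Data.Maybe.Base using (Maybe; just; nothing)
open import Data.List.Base using (List; allFin; map)
open import Data.Nat.ListAction using (sum)
open import Data.Bool.ListAction using (any)
open import Data.Product.Base using (Σ; ∃; _×_; _,_)
open import Data.Sum.Base using (_⊎_; inj₁; inj₂)
open import Relation.Nullary.Decidable.Core using (⌊_⌋)
open import Relation.Nullary.Negation.Core using (¬_)
open import Relation.Binary.PropositionalEquality.Core using (_≡_; _≢_)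
open import Data.Integer.Base using (+_)
open import Data.Rational.Base using (ℚ; _/_) renaming (_*_ to _*ℚ_; _<_ to _<ℚ_)

sumFin : (n : ℕ) → (Fin n → ℕ) → ℕ
sumFin n f = sum (map f (allFin n))

countFin : (n : ℕ) → (Fin n → Bool) → ℕ
countFin n p = sumFin n (λ i → if p i then 1 else 0)

ℕ→ℚ : ℕ → ℚ
ℕ→ℚ k = (+ k) / 1

isJustEq : ∀ {n} → Maybe (Fin n) → Fin n → Bool
isJustEq (just w) v = ⌊ w ≟ v ⌋
isJustEq nothing  v = false

-- Graphs on vertex set Fin n of maximum degree ≤ d, in the bounded
-- degree (adjacency-list) model: adj u i is the i-th neighbour of u,
-- or nothing.

record Graph (n d : ℕ) : Set where
  field
    adj       : Fin n → Fin d → Maybe (Fin n)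
    gap-free  : ∀ u (i j : Fin d) → adj u i ≡ nothing → i <ᶠ j → adj u j ≡ nothing
    no-loop   : ∀ u i → adj u i ≢ just u
    no-dup    : ∀ u (i j : Fin d) v → adj u i ≡ just v → adj u j ≡ just v → i ≡ j
    symmetric : ∀ u i v → adj u i ≡ just v → ∃ λ j → adj v j ≡ just u
open Graph public

edgeB : ∀ {n d} → Graph n d → Fin n → Fin n → Bool
edgeB {n} {d} G u v = any (λ i → isJustEq (adj G u i) v) (allFin d)

diffG : ∀ {n} → (Fin n → Fin n → Bool) → (Fin n → Fin n → Bool) → ℕ
diffG {n} E E' =
  sumFin n (λ u → countFin n (λ v → ⌊ u <? v ⌋ ∧ (E u v xor E' u v)))

ThreeColorable : ∀ {n d} → Graph n d → Set
ThreeColorable {n} G =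
  Σ (Fin n → Fin 3) λ χ → ∀ u v → edgeB G u v ≡ true → χ u ≢ χ v

-- G is ε-far from 3-colorability (distance = #differing edges / (d n),
-- compared against all 3-colorable graphs of max degree ≤ d on Fin n;
-- stated multiplicatively:  ε · d · n < #differing edges)
FarFrom3Col : ∀ {n d} → ℚ → Graph n d → Set
FarFrom3Col {n} {d} ε G =
  ∀ (G' : Graph n d) → ThreeColorable G' →
    (ε *ℚ ℕ→ℚ (d * n)) <ℚ ℕ→ℚ (diffG (edgeB G) (edgeB G'))

-- 3-uniform hypergraphs on Fin N, given by the (Boolean) characteristic
-- function of their hyperedges on ordered triples; it must be invariant
-- under permuting the triple and false on non-distinct triples.

HEdges : ℕ → Set
HEdges N = Fin N → Fin N → Fin N → Bool

degH : ∀ {N} → HEdges N → Fin N → ℕ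
degH {N} E x = sumFin N (λ b → countFin N (λ c → ⌊ b <? c ⌋ ∧ E x b c))

record IsHypergraph {N : ℕ} (Δ : ℕ) (E : HEdges N) : Set where
  field
    swap₁₂   : ∀ a b c → E a b c ≡ E b a c
    swap₂₃   : ∀ a b c → E a b c ≡ E a c b
    distinct : ∀ a b c → E a b c ≡ true → a ≢ b × a ≢ c × b ≢ c
    degree   : ∀ x → degH E x ≤ Δ

record Hypergraph (N Δ : ℕ) : Set where
  field
    edges : HEdges N
    isHG  : IsHypergraph Δ edges
open Hypergraph public

diffH : ∀ {N} → HEdges N → HEdges N → ℕ
diffH {N} E E' =
  sumFin N (λ a → sumFin N (λ b → countFin N (λ c →
    ⌊ a <? b ⌋ ∧ ⌊ b <? c ⌋ ∧ (E a b c xor E' a b c))))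

ThreePartite : ∀ {N} → HEdges N → Set
ThreePartite {N} E =
  Σ (Fin N → Fin 3) λ χ → ∀ a b c → E a b c ≡ true →
    χ a ≢ χ b × χ a ≢ χ c × χ b ≢ χ c

FarFrom3Part : ∀ {N} → (Δ : ℕ) → ℚ → HEdges N → Set
FarFrom3Part {N} Δ ε E =
  ∀ (H : Hypergraph N Δ) → ThreePartite (edges H) →
    (ε *ℚ ℕ→ℚ (Δ * N)) <ℚ ℕ→ℚ (diffH E (edges H))

-- The reduction ρ.  Vertex set Fin (n + n * d): the first n vertices are
-- the vertices of G, vertex n + u·d + j (0-indexed) is the auxiliary
-- vertex (u , j), i.e.  n ↑ʳ combine u j.

origV : ∀ {n} d → Fin n → Fin (n + n * d)
origV {n} d u = u ↑ˡ (n * d)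

auxV : ∀ {n d} → Fin n → Fin d → Fin (n + n * d)
auxV {n} u j = n ↑ʳ combine u j

-- ρtriple G x y z ≡ true  iff  x = u, y = v, z = auxV u j with u < v and
-- v the j-th entry of u's adjacency list (i.e. {u,v} is the j-th edge
-- incident on u)
ρtriple : ∀ {n d} → Graph n d → HEdges (n + n * d)
ρtriple {n} {d} G x y z with splitAt n x | splitAt n y | splitAt n z
... | inj₁ u | inj₁ v | inj₂ k with remQuot d k
...   | (u' , j) = ⌊ u ≟ u' ⌋ ∧ ⌊ u <? v ⌋ ∧ isJustEq (adj G u j) v
ρtriple G x y z | _ | _ | _ = false

ρ : ∀ {n d} → Graph n d → HEdges (n + n * d)
ρ G x y z = ρtriple G x y z ∨ ρtriple G x z y ∨ ρtriple G y x z
          ∨ ρtriple G y z x ∨ ρtriple G z x y ∨ ρtriple G z y x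

-- Local computation: query trees over adjacency-list oracles of graphs
-- in Graph n d.  A query (u , i) returns the i-th entry of u's list.

data QueryTree (n d : ℕ) (A : Set) : Set where
  ret : A → QueryTree n d A
  ask : Fin n → Fin d → (Maybe (Fin n) → QueryTree n d A) → QueryTree n d A

run : ∀ {n d A} → QueryTree n d A → (Fin n → Fin d → Maybe (Fin n)) → A
run (ret a)       o = a
run (ask u i k)   o = run (k (o u i)) o

data AtMostQueries {n d : ℕ} {A : Set} : ℕ → QueryTree n d A → Set where
  ret≤ : ∀ {q a} → AtMostQueries q (ret a)
  ask≤ : ∀ {q u i k} → (∀ r → AtMostQueries q (k r)) →
         AtMostQueries (suc q) (ask u i k)

-- inc is an incidence-list representation (degree bound Δ) of the
-- hyperedge set E: inc x i is the i-th hyperedge at x, given by its two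
-- other vertices, or nothing; every hyperedge at x is listed exactly once.
SamePair : ∀ {N} → Fin N × Fin N → Fin N × Fin N → Set
SamePair (b , c) (b' , c') = (b ≡ b' × c ≡ c') ⊎ (b ≡ c' × c ≡ b')

record Represents {N Δ : ℕ} (inc : Fin N → Fin Δ → Maybe (Fin N × Fin N))
                  (E : HEdges N) : Set where
  field
    sound    : ∀ x i b c → inc x i ≡ just (b , c) → E x b c ≡ true
    complete : ∀ x b c → E x b c ≡ true →
               ∃ λ i → Σ (Fin N × Fin N) λ p → inc x i ≡ just p × SamePair p (b , c)
    unique   : ∀ x i j p p' → inc x i ≡ just p → inc x j ≡ just p' →
               SamePair p p' → i ≡ j

{-# OPTIONS --safe #-}
module Submission where

-- A proper 3-colouring of G extends to a 3-partition of ρ(G) by giving auxV u j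
-- a colour different from those of u and v.  Conversely, let H be 3-partite with colouring χ.
-- Deleting from G the edges that are monochromatic under χ leaves a 3-colourable graph G′, and
-- each deleted edge {u, v} yields its own hyperedge {u, v, auxV u j} of ρ(G) that H misses, so
-- G′ differs from G in no more places than H from ρ(G).  Distances of graphs are normalised by
-- d n and those of ρ(G) by Δ′ (1 + d) n with Δ′ = 1 + d + d², whence c = 1 / (Δ′ (1 + d)); for
-- d = 0 no graph is far from 3-colourable.  Incidence lists of ρ(G) need at most two adjacency
-- queries: at v, a hyperedge {w, v, auxV w j} with w < v is found by asking for the k-th
-- neighbour w of v and then for the j-th neighbour of w.

open import Algebra.Properties.CommutativeMonoid.Sum as Sum using ()
open import Data.Bool.Base using (Bool; true; false; _∧_; _∨_; _xor_; if_then_else_)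
open import Data.Bool.Properties using (T-≡; ∨-zeroʳ; ∧-zeroʳ; xor-same; ⇔→≡)
open import Data.Fin.Base using (Fin; zero; suc; toℕ; _↑ˡ_; _↑ʳ_; splitAt; combine; remQuot; quotRem; _<_)
open import Data.Fin.Patterns using (0F; 1F; 2F)
open import Data.Fin.Properties
  using (_≟_; _<?_; suc-injective; 0≢1+n; toℕ<n; toℕ-↑ˡ; toℕ-↑ʳ; ↑ˡ-injective; ↑ʳ-injective; <⇒≢; <-asym;
         splitAt-↑ˡ; splitAt-↑ʳ; splitAt⁻¹-↑ˡ; splitAt⁻¹-↑ʳ; remQuot-combine; combine-remQuot; combine-injective)
import Data.Integer.Base as ℤ
open import Data.Integer.Properties using (pos-*; *-monoʳ-≤-nonNeg)
open import Data.List.Base using (List; []; _∷_; _?∷_; tabulate; length; allFin)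
open import Data.List.Membership.Propositional using (_∈_; lose)
open import Data.List.Membership.Propositional.Properties using (∈-allFin)
open import Data.List.Properties using (map-tabulate)
import Data.List.Relation.Unary.All as All
open import Data.List.Relation.Unary.Any using (satisfied; here; there)
open import Data.List.Relation.Unary.Any.Properties using (any⁺; any⁻)
open import Data.List.Relation.Unary.Unique.Propositional using (Unique; []; _∷_)
open import Data.Maybe.Base as Maybe using (Maybe; just; nothing; maybe; when)
open import Data.Nat.Base as ℕ using (ℕ; zero; suc; _+_; _*_; _≤_; z≤n; s≤s)
open import Data.Nat.Coprimality as Coprime using (1-coprimeTo)
import Data.Nat.ListAction as List
open import Data.Nat.Properties as ℕ using (+-0-commutativeMonoid)
open import Data.Product.Base using (Σ; ∃; ∃₂; _×_; _,_; proj₁; proj₂; uncurry; swap)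
open import Data.Product.Properties using (≡-dec)
open import Data.Rational.Base as ℚ using (ℚ; mkℚ; 0ℚ; 1ℚ; _/_; 1/_)
  renaming (_*_ to _*ℚ_; _<_ to _<ℚ_; _≤_ to _≤ℚ_)
import Data.Rational.Properties as ℚ
open import Data.Sum.Base using (_⊎_; inj₁; inj₂; [_,_]′)
open import Function.Base using (_∘_; id)
open import Function.Bundles using (Equivalence; mk⇔)
open import Relation.Binary.Definitions using (DecidableEquality)
open import Relation.Binary.PropositionalEquality
  using (_≡_; _≢_; refl; sym; trans; cong; cong₂; subst; subst₂; ≢-sym; module ≡-Reasoning)
open import Relation.Nullary.Decidable using (Dec; yes; no; ⌊_⌋; ¬?)
open import Relation.Nullary.Negation using (¬_; contradiction)

open import Defs

open Sum +-0-commutativeMonoid using (sum; sum-syntax; sum-cong-≗; ∑-comm; sum-replicate-zero)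

toWitness≡ : ∀ {A : Set} (a? : Dec A) → ⌊ a? ⌋ ≡ true → A
toWitness≡ (yes a) _ = a
toWitness≡ (no _)  ()

fromWitness≡ : ∀ {A : Set} (a? : Dec A) → A → ⌊ a? ⌋ ≡ true
fromWitness≡ (yes _) _ = refl
fromWitness≡ (no ¬a) a = contradiction a ¬a

fromWitnessFalse≡ : ∀ {A : Set} (a? : Dec A) → ¬ A → ⌊ a? ⌋ ≡ false
fromWitnessFalse≡ (yes a) ¬a = contradiction a ¬a
fromWitnessFalse≡ (no _)  _  = refl

∧-true⁻¹ : ∀ a {b} → a ∧ b ≡ true → a ≡ true × b ≡ true
∧-true⁻¹ true b≡true = refl , b≡true

∨-true⁻¹ : ∀ a {b} → a ∨ b ≡ true → a ≡ true ⊎ b ≡ true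
∨-true⁻¹ true  _      = inj₁ refl
∨-true⁻¹ false b≡true = inj₂ b≡true

∨-introˡ : ∀ {a b} → a ≡ true → a ∨ b ≡ true
∨-introˡ refl = refl

infixr 4 _∨ʳ_
_∨ʳ_ : ∀ a {b} → b ≡ true → a ∨ b ≡ true
a ∨ʳ refl = ∨-zeroʳ a

isJustEq-true : ∀ {n} (m : Maybe (Fin n)) v → isJustEq m v ≡ true → m ≡ just v
isJustEq-true (just w) v eq = cong just (toWitness≡ (w ≟ v) eq)

isJustEq-just : ∀ {n} (v : Fin n) → isJustEq (just v) v ≡ true
isJustEq-just v = fromWitness≡ (v ≟ v) refl

keep : ∀ {A : Set} {Q : A → Set} → (∀ a → Dec (Q a)) → Maybe A → Maybe A
keep Q? nothing  = nothing
keep Q? (just a) = if ⌊ Q? a ⌋ then just a else nothing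

module _ {A : Set} {Q : A → Set} (Q? : ∀ a → Dec (Q a)) where

  keep-just : ∀ m {a} → keep Q? m ≡ just a → Q a × m ≡ just a
  keep-just (just b) eq with Q? b
  keep-just (just b) refl | yes q = q , refl

  keep-intro : ∀ {a} → Q a → keep Q? (just a) ≡ just a
  keep-intro {a} q rewrite fromWitness≡ (Q? a) q = refl

when-just : ∀ {A : Set} b {a a′ : A} → when b a ≡ just a′ → b ≡ true × a ≡ a′
when-just true refl = refl , refl

sumFin≡∑ : ∀ n (f : Fin n → ℕ) → sumFin n f ≡ ∑[ i < n ] f i
sumFin≡∑ n f = trans (cong List.sum (map-tabulate id f)) (sum-tabulate n f)
  where
  sum-tabulate : ∀ n (f : Fin n → ℕ) → List.sum (tabulate f) ≡ sum f
  sum-tabulate zero    f = refl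
  sum-tabulate (suc n) f = cong (f zero +_) (sum-tabulate n (f ∘ suc))

sumFin²≡∑² : ∀ m n (f : Fin m → Fin n → ℕ) →
             sumFin m (λ a → sumFin n (f a)) ≡ ∑[ a < m ] ∑[ b < n ] f a b
sumFin²≡∑² m n f = trans (sumFin≡∑ m _) (sum-cong-≗ (λ a → sumFin≡∑ n (f a)))

𝟙 : Bool → ℕ
𝟙 b = if b then 1 else 0

∑-one : ∀ n → ∑[ i < n ] 1 ≡ n
∑-one zero    = refl
∑-one (suc n) = cong suc (∑-one n)

∑-mono-≤ : ∀ {n} {f g : Fin n → ℕ} → (∀ i → f i ≤ g i) → ∑[ i < n ] f i ≤ ∑[ i < n ] g i
∑-mono-≤ {zero}  f≤g = z≤n
∑-mono-≤ {suc n} f≤g = ℕ.+-mono-≤ (f≤g zero) (∑-mono-≤ (f≤g ∘ suc))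

term≤∑ : ∀ {n} (f : Fin n → ℕ) i → f i ≤ ∑[ j < n ] f j
term≤∑ f zero    = ℕ.m≤m+n _ _
term≤∑ f (suc i) = ℕ.≤-trans (term≤∑ (f ∘ suc) i) (ℕ.m≤n+m _ _)

∑-zero : ∀ {n} {f : Fin n → ℕ} → (∀ i → f i ≡ 0) → ∑[ i < n ] f i ≡ 0
∑-zero {n} f≡0 = trans (sum-cong-≗ f≡0) (sum-replicate-zero n)

∑-single : ∀ {n} {f : Fin n → ℕ} a → (∀ i → i ≢ a → f i ≡ 0) → ∑[ i < n ] f i ≡ f a
∑-single {f = f} zero f≡0 =
  trans (cong (f zero +_) (∑-zero (λ i → f≡0 (suc i) λ ()))) (ℕ.+-identityʳ (f zero))
∑-single {f = f} (suc a) f≡0 =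
  cong₂ _+_ (f≡0 zero λ ()) (∑-single a (λ i i≢a → f≡0 (suc i) (i≢a ∘ suc-injective)))

∑∑-single : ∀ {m n} {f : Fin m → Fin n → ℕ} a b → (∀ i j → (i , j) ≢ (a , b) → f i j ≡ 0) →
            ∑[ i < m ] ∑[ j < n ] f i j ≡ f a b
∑∑-single {f = f} a b f≡0 =
  trans (∑-single {f = λ i → ∑[ j < _ ] f i j} a (λ i i≢a → ∑-zero (λ j → f≡0 i j (i≢a ∘ cong proj₁))))
        (∑-single {f = f a} b (λ j j≢b → f≡0 a j (j≢b ∘ cong proj₂)))

∑-↑ˡ-≤ : ∀ m k (f : Fin (m + k) → ℕ) → ∑[ i < m ] f (i ↑ˡ k) ≤ ∑[ i < m + k ] f i
∑-↑ˡ-≤ zero    k f = z≤n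
∑-↑ˡ-≤ (suc m) k f = ℕ.+-monoʳ-≤ (f zero) (∑-↑ˡ-≤ m k (f ∘ suc))

Distinct₃ : ∀ {B : Set} → B → B → B → Set
Distinct₃ a b c = a ≢ b × a ≢ c × b ≢ c

distinct₃-swap₁₂ : ∀ {B : Set} {a b c : B} → Distinct₃ a b c → Distinct₃ b a c
distinct₃-swap₁₂ (a≢b , a≢c , b≢c) = ≢-sym a≢b , b≢c , a≢c

distinct₃-swap₂₃ : ∀ {B : Set} {a b c : B} → Distinct₃ a b c → Distinct₃ a c b
distinct₃-swap₂₃ (a≢b , a≢c , b≢c) = a≢c , a≢b , ≢-sym b≢c

Rainbow : ∀ {A B : Set} → (A → B) → A → A → A → Set
Rainbow f x y z = Distinct₃ (f x) (f y) (f z)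

data UpToOrder {A : Set} (R : A → A → A → Set) (x y z : A) : Set where
  xyz : R x y z → UpToOrder R x y z
  xzy : R x z y → UpToOrder R x y z
  yxz : R y x z → UpToOrder R x y z
  yzx : R y z x → UpToOrder R x y z
  zxy : R z x y → UpToOrder R x y z
  zyx : R z y x → UpToOrder R x y z

module _ {A : Set} {R : A → A → A → Set} {x y z : A} where

  upToOrder-map : ∀ {S : A → A → A → Set} → (∀ {a b c} → R a b c → S a b c) →
                  UpToOrder R x y z → UpToOrder S x y z
  upToOrder-map f (xyz r) = xyz (f r)
  upToOrder-map f (xzy r) = xzy (f r)
  upToOrder-map f (yxz r) = yxz (f r)
  upToOrder-map f (yzx r) = yzx (f r)
  upToOrder-map f (zxy r) = zxy (f r)
  upToOrder-map f (zyx r) = zyx (f r)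

  upToOrder-swap₁₂ : UpToOrder R x y z → UpToOrder R y x z
  upToOrder-swap₁₂ (xyz r) = yxz r
  upToOrder-swap₁₂ (xzy r) = yzx r
  upToOrder-swap₁₂ (yxz r) = xyz r
  upToOrder-swap₁₂ (yzx r) = xzy r
  upToOrder-swap₁₂ (zxy r) = zyx r
  upToOrder-swap₁₂ (zyx r) = zxy r

  upToOrder-swap₂₃ : UpToOrder R x y z → UpToOrder R x z y
  upToOrder-swap₂₃ (xyz r) = xzy r
  upToOrder-swap₂₃ (xzy r) = xyz r
  upToOrder-swap₂₃ (yxz r) = zxy r
  upToOrder-swap₂₃ (yzx r) = zyx r
  upToOrder-swap₂₃ (zxy r) = yxz r
  upToOrder-swap₂₃ (zyx r) = yzx r

  upToOrder-rainbow : ∀ {B : Set} {f : A → B} → (∀ {a b c} → R a b c → Rainbow f a b c) →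
                      UpToOrder R x y z → Rainbow f x y z
  upToOrder-rainbow rainbow (xyz r) = rainbow r
  upToOrder-rainbow rainbow (xzy r) = distinct₃-swap₂₃ (rainbow r)
  upToOrder-rainbow rainbow (yxz r) = distinct₃-swap₁₂ (rainbow r)
  upToOrder-rainbow rainbow (yzx r) = distinct₃-swap₁₂ (distinct₃-swap₂₃ (rainbow r))
  upToOrder-rainbow rainbow (zxy r) = distinct₃-swap₂₃ (distinct₃-swap₁₂ (rainbow r))
  upToOrder-rainbow rainbow (zyx r) = distinct₃-swap₁₂ (distinct₃-swap₂₃ (distinct₃-swap₁₂ (rainbow r)))

anyOrder : ∀ {A : Set} → (A → A → A → Bool) → A → A → A → Bool
anyOrder t x y z = t x y z ∨ t x z y ∨ t y x z ∨ t y z x ∨ t z x y ∨ t z y x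

module _ {A : Set} (t : A → A → A → Bool) where

  Holds : A → A → A → Set
  Holds a b c = t a b c ≡ true

  anyOrder⇒upToOrder : ∀ {x y z} → anyOrder t x y z ≡ true → UpToOrder Holds x y z
  anyOrder⇒upToOrder {x} {y} {z} h with ∨-true⁻¹ (t x y z) h
  ... | inj₁ e = xyz e
  ... | inj₂ h with ∨-true⁻¹ (t x z y) h
  ... | inj₁ e = xzy e
  ... | inj₂ h with ∨-true⁻¹ (t y x z) h
  ... | inj₁ e = yxz e
  ... | inj₂ h with ∨-true⁻¹ (t y z x) h
  ... | inj₁ e = yzx e
  ... | inj₂ h with ∨-true⁻¹ (t z x y) h
  ... | inj₁ e = zxy e
  ... | inj₂ e = zyx e

  upToOrder⇒anyOrder : ∀ {x y z} → UpToOrder Holds x y z → anyOrder t x y z ≡ true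
  upToOrder⇒anyOrder         (xyz e) = ∨-introˡ e
  upToOrder⇒anyOrder {x} {y} {z} (xzy e) = t x y z ∨ʳ ∨-introˡ e
  upToOrder⇒anyOrder {x} {y} {z} (yxz e) = t x y z ∨ʳ t x z y ∨ʳ ∨-introˡ e
  upToOrder⇒anyOrder {x} {y} {z} (yzx e) = t x y z ∨ʳ t x z y ∨ʳ t y x z ∨ʳ ∨-introˡ e
  upToOrder⇒anyOrder {x} {y} {z} (zxy e) = t x y z ∨ʳ t x z y ∨ʳ t y x z ∨ʳ t y z x ∨ʳ ∨-introˡ e
  upToOrder⇒anyOrder {x} {y} {z} (zyx e) = t x y z ∨ʳ t x z y ∨ʳ t y x z ∨ʳ t y z x ∨ʳ t z x y ∨ʳ e

  anyOrder-swap₁₂ : ∀ x y z → anyOrder t x y z ≡ anyOrder t y x z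
  anyOrder-swap₁₂ x y z = ⇔→≡ (mk⇔ (upToOrder⇒anyOrder ∘ upToOrder-swap₁₂ ∘ anyOrder⇒upToOrder)
                                    (upToOrder⇒anyOrder ∘ upToOrder-swap₁₂ ∘ anyOrder⇒upToOrder))

  anyOrder-swap₂₃ : ∀ x y z → anyOrder t x y z ≡ anyOrder t x z y
  anyOrder-swap₂₃ x y z = ⇔→≡ (mk⇔ (upToOrder⇒anyOrder ∘ upToOrder-swap₂₃ ∘ anyOrder⇒upToOrder)
                                    (upToOrder⇒anyOrder ∘ upToOrder-swap₂₃ ∘ anyOrder⇒upToOrder))

data OrigOrAux {m k : ℕ} : Fin (m + m * k) → Set where
  orig : (u : Fin m) → OrigOrAux (origV k u)
  aux  : (u : Fin m) (j : Fin k) → OrigOrAux (auxV u j)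

auxV-remQuot : ∀ {m k} {i : Fin (m * k)} {u : Fin m} {j : Fin k} → remQuot k i ≡ (u , j) → auxV u j ≡ m ↑ʳ i
auxV-remQuot {m} {k} {i} eq =
  cong (m ↑ʳ_) (trans (cong (uncurry combine) (sym eq)) (combine-remQuot {m} k i))

quotRem-combine : ∀ {m k} (u : Fin m) (j : Fin k) → quotRem {m} k (combine u j) ≡ (j , u)
quotRem-combine u j = cong swap (remQuot-combine u j)

origOrAux : ∀ {m k} (x : Fin (m + m * k)) → OrigOrAux x
origOrAux {m} {k} x with splitAt m x in eq
... | inj₁ u = subst OrigOrAux (splitAt⁻¹-↑ˡ eq) (orig u)
... | inj₂ i = subst OrigOrAux (trans (auxV-remQuot {m} {k} refl) (splitAt⁻¹-↑ʳ eq)) (aux _ _)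

caseOrigAux : ∀ {m k} {A : Set} → (Fin m → A) → (Fin m → Fin k → A) → Fin (m + m * k) → A
caseOrigAux {m} {k} f g x = [ f , uncurry g ∘ remQuot k ]′ (splitAt m x)

module _ {m k : ℕ} {A : Set} (f : Fin m → A) (g : Fin m → Fin k → A) where

  caseOrigAux-origV : ∀ u → caseOrigAux f g (origV k u) ≡ f u
  caseOrigAux-origV u = cong [ f , uncurry g ∘ remQuot k ]′ (splitAt-↑ˡ m u (m * k))

  caseOrigAux-auxV : ∀ u j → caseOrigAux f g (auxV u j) ≡ g u j
  caseOrigAux-auxV u j = begin
    caseOrigAux f g (auxV u j)           ≡⟨ cong [ f , uncurry g ∘ remQuot k ]′ (splitAt-↑ʳ m (m * k) (combine u j)) ⟩
    uncurry g (remQuot k (combine u j))  ≡⟨ cong (uncurry g) (remQuot-combine u j) ⟩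
    g u j                                ∎
    where open ≡-Reasoning

  caseOrigAux-all : (P : A → Set) → (∀ u → P (f u)) → (∀ u j → P (g u j)) →
                    ∀ x → P (caseOrigAux f g x)
  caseOrigAux-all P Pf Pg x with splitAt m x
  ... | inj₁ u = Pf u
  ... | inj₂ i = Pg _ _

module _ {n d : ℕ} where

  origV-injective : ∀ {u v : Fin n} → origV d u ≡ origV d v → u ≡ v
  origV-injective = ↑ˡ-injective (n * d) _ _

  auxV-injective : ∀ {u u′ : Fin n} {j j′ : Fin d} → auxV u j ≡ auxV u′ j′ → u ≡ u′ × j ≡ j′
  auxV-injective eq = combine-injective _ _ _ _ (↑ʳ-injective n _ _ eq)

  origV-mono-< : ∀ {u v : Fin n} → u < v → origV d u < origV d v
  origV-mono-< {u} {v} = subst₂ ℕ._<_ (sym (toℕ-↑ˡ u (n * d))) (sym (toℕ-↑ˡ v (n * d)))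

  origV<auxV : ∀ (v u : Fin n) (j : Fin d) → origV d v < auxV u j
  origV<auxV v u j = begin-strict
    toℕ (origV d v)        ≡⟨ toℕ-↑ˡ v (n * d) ⟩
    toℕ v                  <⟨ toℕ<n v ⟩
    n                      ≤⟨ ℕ.m≤m+n n _ ⟩
    n + toℕ (combine u j)  ≡⟨ toℕ-↑ʳ n (combine u j) ⟨
    toℕ (auxV u j)         ∎
    where open ℕ.≤-Reasoning

  origV≢auxV : ∀ (v u : Fin n) (j : Fin d) → origV d v ≢ auxV u j
  origV≢auxV v u j = <⇒≢ (origV<auxV v u j)

Vertex : ℕ → ℕ → Set
Vertex n d = Fin (n + n * d)

module _ {n d : ℕ} (G : Graph n d) where

  Adj : Fin n → Fin n → Set
  Adj u v = ∃ λ i → adj G u i ≡ just v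

  edgeB⇒Adj : ∀ {u v} → edgeB G u v ≡ true → Adj u v
  edgeB⇒Adj {u} {v} e with satisfied (any⁻ _ (allFin d) (Equivalence.from T-≡ e))
  ... | i , hit = i , isJustEq-true _ v (Equivalence.to T-≡ hit)

  Adj⇒edgeB : ∀ {u v} → Adj u v → edgeB G u v ≡ true
  Adj⇒edgeB {u} {v} (i , eq) =
    Equivalence.to T-≡ (any⁺ _ (lose (∈-allFin i) (Equivalence.from T-≡ hit)))
    where
    hit : isJustEq (adj G u i) v ≡ true
    hit rewrite eq = isJustEq-just v

  upNeighbour : Fin n → Fin d → Maybe (Fin n)
  upNeighbour u j = keep (u <?_) (adj G u j)

  upNeighbour-just : ∀ {u j v} → upNeighbour u j ≡ just v → u < v × adj G u j ≡ just v
  upNeighbour-just {u} {j} = keep-just (u <?_) (adj G u j)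

  upNeighbour-intro : ∀ {u j v} → u < v → adj G u j ≡ just v → upNeighbour u j ≡ just v
  upNeighbour-intro {u} u<v eq rewrite eq = keep-intro (u <?_) u<v

  upNeighbour⇒Adj-flip : ∀ {u j v} → upNeighbour u j ≡ just v → Adj v u
  upNeighbour⇒Adj-flip up = symmetric G _ _ _ (proj₂ (upNeighbour-just up))

  data Canonical : (x y z : Vertex n d) → Set where
    canonical : ∀ {u j v} → upNeighbour u j ≡ just v → Canonical (origV d u) (origV d v) (auxV u j)

  ρtriple⇒Canonical : ∀ x y z → ρtriple G x y z ≡ true → Canonical x y z
  ρtriple⇒Canonical x y z h with splitAt n x in ex | splitAt n y in ey | splitAt n z in ez
  ... | inj₁ u | inj₁ v | inj₂ k with quotRem {n} d k in ek
  ...   | (j , u′) with ∧-true⁻¹ ⌊ u ≟ u′ ⌋ h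
  ...     | u≟u′ , h′ with toWitness≡ (u ≟ u′) u≟u′ | ∧-true⁻¹ ⌊ u <? v ⌋ h′
  ...       | refl | u<?v , adj≡v =
    at (splitAt⁻¹-↑ˡ ex) (splitAt⁻¹-↑ˡ ey) (trans (auxV-remQuot (cong swap ek)) (splitAt⁻¹-↑ʳ ez))
       (upNeighbour-intro (toWitness≡ (u <? v) u<?v) (isJustEq-true _ v adj≡v))
    where
    at : ∀ {x y z u v j} → origV d u ≡ x → origV d v ≡ y → auxV u j ≡ z →
         upNeighbour u j ≡ just v → Canonical x y z
    at refl refl refl = canonical
  ρtriple⇒Canonical x y z () | inj₁ _ | inj₁ _ | inj₁ _
  ρtriple⇒Canonical x y z () | inj₁ _ | inj₂ _ | _
  ρtriple⇒Canonical x y z () | inj₂ _ | _      | _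

  Canonical⇒ρtriple : ∀ {x y z} → Canonical x y z → ρtriple G x y z ≡ true
  Canonical⇒ρtriple (canonical {u} {j} {v} up) with upNeighbour-just up
  ... | u<v , adj≡v
    rewrite splitAt-↑ˡ n u (n * d) | splitAt-↑ˡ n v (n * d) | splitAt-↑ʳ n (n * d) (combine u j)
          | quotRem-combine u j | fromWitness≡ (u ≟ u) refl | fromWitness≡ (u <? v) u<v | adj≡v
          | isJustEq-just v
    = refl

  ρ⇒canonical : ∀ {x y z} → ρ G x y z ≡ true → UpToOrder Canonical x y z
  ρ⇒canonical = upToOrder-map (ρtriple⇒Canonical _ _ _) ∘ anyOrder⇒upToOrder (ρtriple G)

  canonical⇒ρ : ∀ {x y z} → UpToOrder Canonical x y z → ρ G x y z ≡ true
  canonical⇒ρ = upToOrder⇒anyOrder (ρtriple G) ∘ upToOrder-map Canonical⇒ρtriple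

  canonical-distinct : ∀ {x y z} → Canonical x y z → Rainbow id x y z
  canonical-distinct (canonical {u} {j} {v} up) =
    <⇒≢ (origV-mono-< (proj₁ (upNeighbour-just up))) , origV≢auxV u u j , origV≢auxV v u j

  ρ-distinct : ∀ a b c → ρ G a b c ≡ true → Rainbow id a b c
  ρ-distinct a b c = upToOrder-rainbow canonical-distinct ∘ ρ⇒canonical

avoid : (a b : Fin 3) → ∃ λ c → c ≢ a × c ≢ b
avoid 0F      0F      = 1F , (λ ()) , (λ ())
avoid 0F      1F      = 2F , (λ ()) , (λ ())
avoid 0F      2F      = 1F , (λ ()) , (λ ())
avoid 1F      0F      = 2F , (λ ()) , (λ ())
avoid 2F      0F      = 1F , (λ ()) , (λ ())
avoid (suc _) (suc _) = 0F , (λ ()) , (λ ())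

module _ {n d : ℕ} (G : Graph n d) where

  auxColour : (Fin n → Fin 3) → Fin n → Fin d → Fin 3
  auxColour χ u j = proj₁ (avoid (χ u) (maybe χ (χ u) (adj G u j)))

  ρ-threePartite : ThreeColorable G → ThreePartite (ρ G)
  ρ-threePartite (χ , proper) = χ′ , λ a b c → upToOrder-rainbow rainbow ∘ ρ⇒canonical G
    where
    χ′ : Vertex n d → Fin 3
    χ′ = caseOrigAux χ (auxColour χ)

    rainbow : ∀ {x y z} → Canonical G x y z → Rainbow χ′ x y z
    rainbow (canonical {u} {j} {v} up) with upNeighbour-just G up
    ... | _ , adj≡v rewrite caseOrigAux-origV χ (auxColour χ) u | caseOrigAux-origV χ (auxColour χ) v
                          | caseOrigAux-auxV χ (auxColour χ) u j | adj≡v =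
      let c≢χu , c≢χv = proj₂ (avoid (χ u) (χ v)) in
      proper u v (Adj⇒edgeB G (j , adj≡v)) , ≢-sym c≢χu , ≢-sym c≢χv

-- Slot layout of the incidence lists: the auxiliary vertex auxV u j lists its hyperedge in slot
-- zero; an original vertex lists the hyperedge of its j-th edge in lowSlot j if it is the lower
-- endpoint of that edge, and in highSlot k j if the lower endpoint is its k-th neighbour w and
-- the edge is the j-th edge of w.  (The suc-part of a slot is split like the vertices of ρ(G).)
Slot : ℕ → Set
Slot d = Fin (suc (d + d * d))

lowSlot : ∀ {d} → Fin d → Slot d
lowSlot {d} j = suc (origV d j)

highSlot : ∀ {d} → Fin d → Fin d → Slot d
highSlot k j = suc (auxV k j)

module Queries {n d : ℕ} where

  Answer : Set
  Answer = Maybe (Vertex n d × Vertex n d)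

  withUpNeighbour : ∀ {A : Set} → Fin n → Fin d → (Maybe (Fin n) → A) → QueryTree n d A
  withUpNeighbour u j k = ask u j (ret ∘ k ∘ keep (u <?_))

  lowQuery : Fin n → Fin d → QueryTree n d Answer
  lowQuery u j = withUpNeighbour u j (Maybe.map λ v → origV d v , auxV u j)

  highQuery : Fin n → Fin d → Fin d → QueryTree n d Answer
  highQuery v k j = ask v k λ
    { nothing  → ret nothing
    ; (just u) → withUpNeighbour u j λ w → when (isJustEq w v) (origV d u , auxV u j)
    }

  auxQuery : Fin n → Fin d → QueryTree n d Answer
  auxQuery u j = withUpNeighbour u j (Maybe.map λ v → origV d u , origV d v)

  origQueries : Fin n → Slot d → QueryTree n d Answer
  origQueries u zero    = ret nothing
  origQueries u (suc s) = caseOrigAux (lowQuery u) (highQuery u) s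

  auxQueries : Fin n → Fin d → Slot d → QueryTree n d Answer
  auxQueries u j zero    = auxQuery u j
  auxQueries u j (suc _) = ret nothing

  incidenceQuery : Vertex n d → Slot d → QueryTree n d Answer
  incidenceQuery = caseOrigAux origQueries auxQueries

  incidenceQuery-queries : ∀ x i → AtMostQueries 2 (incidenceQuery x i)
  incidenceQuery-queries =
    caseOrigAux-all origQueries auxQueries (λ q → ∀ i → AtMostQueries 2 (q i)) origQueries≤ auxQueries≤
    where
    origQueries≤ : ∀ u i → AtMostQueries 2 (origQueries u i)
    origQueries≤ u zero    = ret≤
    origQueries≤ u (suc s) = caseOrigAux-all (lowQuery u) (highQuery u) (AtMostQueries 2)
      (λ j → ask≤ (λ _ → ret≤))
      (λ k j → ask≤ λ { nothing → ret≤ ; (just _) → ask≤ (λ _ → ret≤) }) s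

    auxQueries≤ : ∀ u j i → AtMostQueries 2 (auxQueries u j i)
    auxQueries≤ u j zero    = ask≤ (λ _ → ret≤)
    auxQueries≤ u j (suc _) = ret≤

module _ {n d : ℕ} (G : Graph n d) where

  open Queries {n} {d}

  data Incidence (x : Vertex n d) : Slot d → Vertex n d × Vertex n d → Set where
    atLow  : ∀ {u j v} → x ≡ origV d u → upNeighbour G u j ≡ just v →
             Incidence x (lowSlot j) (origV d v , auxV u j)
    atHigh : ∀ {u j v k} → x ≡ origV d v → adj G v k ≡ just u → upNeighbour G u j ≡ just v →
             Incidence x (highSlot k j) (origV d u , auxV u j)
    atAux  : ∀ {u j v} → x ≡ auxV u j → upNeighbour G u j ≡ just v →
             Incidence x zero (origV d u , origV d v)

  infix 4 _⇓_
  _⇓_ : QueryTree n d Answer → Vertex n d × Vertex n d → Set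
  q ⇓ p = run q (adj G) ≡ just p

  incidence⇒run : ∀ {x i p} → Incidence x i p → incidenceQuery x i ⇓ p
  incidence⇒run (atLow {u} {j} refl up)
    rewrite caseOrigAux-origV origQueries auxQueries u | caseOrigAux-origV (lowQuery u) (highQuery u) j
          | up = refl
  incidence⇒run (atHigh {u} {j} {v} {k} refl adj≡u up)
    rewrite caseOrigAux-origV origQueries auxQueries v | caseOrigAux-auxV (lowQuery v) (highQuery v) k j
          | adj≡u | up | isJustEq-just v = refl
  incidence⇒run (atAux {u} {j} refl up)
    rewrite caseOrigAux-auxV origQueries auxQueries u j | up = refl

  run⇒incidence : ∀ x i {p} → incidenceQuery x i ⇓ p → Incidence x i p
  run⇒incidence x i {p} h with origOrAux {n} {d} x
  ... | orig u  = atOrig i (subst (λ q → q i ⇓ p) (caseOrigAux-origV origQueries auxQueries u) h)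
    where
    atLowSlot : ∀ {j} → lowQuery u j ⇓ p → Incidence (origV d u) (lowSlot j) p
    atLowSlot {j} h with upNeighbour G u j in up
    atLowSlot refl | just v = atLow refl up

    atHighSlot : ∀ {k j} → highQuery u k j ⇓ p → Incidence (origV d u) (highSlot k j) p
    atHighSlot {k} {j} h with adj G u k in adj≡w
    ... | just w with when-just (isJustEq (upNeighbour G w j) u) h
    ...   | isUp , refl = atHigh refl adj≡w (isJustEq-true _ u isUp)

    atOrig : ∀ i → origQueries u i ⇓ p → Incidence (origV d u) i p
    atOrig (suc s) h with origOrAux {d} {d} s
    ... | orig j  = atLowSlot (subst (_⇓ p) (caseOrigAux-origV (lowQuery u) (highQuery u) j) h)
    ... | aux k j = atHighSlot (subst (_⇓ p) (caseOrigAux-auxV (lowQuery u) (highQuery u) k j) h)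
  ... | aux u j = atAuxV i (subst (λ q → q i ⇓ p) (caseOrigAux-auxV origQueries auxQueries u j) h)
    where
    atAuxV : ∀ i → auxQueries u j i ⇓ p → Incidence (auxV u j) i p
    atAuxV zero h with upNeighbour G u j in up
    atAuxV zero refl | just v = atAux refl up

  incidence⇒canonical : ∀ {x i b c} → Incidence x i (b , c) → UpToOrder (Canonical G) x b c
  incidence⇒canonical (atLow refl up)    = xyz (canonical up)
  incidence⇒canonical (atHigh refl _ up) = yxz (canonical up)
  incidence⇒canonical (atAux refl up)    = yzx (canonical up)

  canonical⇒incidence : ∀ {x b c} → UpToOrder (Canonical G) x b c →
                        ∃₂ λ i p → Incidence x i p × SamePair p (b , c)
  canonical⇒incidence (xyz (canonical up)) = _ , _ , atLow refl up , inj₁ (refl , refl)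
  canonical⇒incidence (xzy (canonical up)) = _ , _ , atLow refl up , inj₂ (refl , refl)
  canonical⇒incidence (yxz (canonical up)) =
    let k , adj≡u = upNeighbour⇒Adj-flip G up in _ , _ , atHigh refl adj≡u up , inj₁ (refl , refl)
  canonical⇒incidence (yzx (canonical up)) = _ , _ , atAux refl up , inj₁ (refl , refl)
  canonical⇒incidence (zxy (canonical up)) =
    let k , adj≡u = upNeighbour⇒Adj-flip G up in _ , _ , atHigh refl adj≡u up , inj₂ (refl , refl)
  canonical⇒incidence (zyx (canonical up)) = _ , _ , atAux refl up , inj₂ (refl , refl)

  samePair-origV-auxV : ∀ {a a′ u u′ : Fin n} {j j′ : Fin d} →
                        SamePair (origV d a , auxV u j) (origV d a′ , auxV u′ j′) →
                        a ≡ a′ × u ≡ u′ × j ≡ j′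
  samePair-origV-auxV (inj₁ (eq₁ , eq₂)) = origV-injective eq₁ , auxV-injective eq₂
  samePair-origV-auxV (inj₂ (eq₁ , _))   = contradiction eq₁ (origV≢auxV _ _ _)

  incidence-unique : ∀ {x i i′ p p′} → Incidence x i p → Incidence x i′ p′ → SamePair p p′ → i ≡ i′
  incidence-unique (atAux _ _) (atAux _ _) _ = refl
  incidence-unique (atAux x≡ _) (atLow x≡′ _) _      = contradiction (trans (sym x≡′) x≡) (origV≢auxV _ _ _)
  incidence-unique (atAux x≡ _) (atHigh x≡′ _ _) _   = contradiction (trans (sym x≡′) x≡) (origV≢auxV _ _ _)
  incidence-unique (atLow x≡ _) (atAux x≡′ _) _      = contradiction (trans (sym x≡) x≡′) (origV≢auxV _ _ _)
  incidence-unique (atHigh x≡ _ _) (atAux x≡′ _) _   = contradiction (trans (sym x≡) x≡′) (origV≢auxV _ _ _)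
  incidence-unique (atLow _ _) (atLow _ _) same with samePair-origV-auxV same
  ... | _ , _ , refl = refl
  incidence-unique (atLow x≡ _) (atHigh x≡′ _ up′) same with samePair-origV-auxV same
  ... | _ , refl , _ = contradiction (origV-injective (trans (sym x≡) x≡′)) (<⇒≢ (proj₁ (upNeighbour-just G up′)))
  incidence-unique (atHigh x≡ _ up) (atLow x≡′ _) same with samePair-origV-auxV same
  ... | _ , refl , _ = contradiction (origV-injective (trans (sym x≡′) x≡)) (<⇒≢ (proj₁ (upNeighbour-just G up)))
  incidence-unique (atHigh x≡ adj≡u _) (atHigh x≡′ adj≡u′ _) same
    with samePair-origV-auxV same | origV-injective (trans (sym x≡) x≡′)
  ... | refl , refl , refl | refl = cong (λ k → highSlot k _) (no-dup G _ _ _ _ adj≡u adj≡u′)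

  incidenceQuery-represents : Represents (λ x i → run (incidenceQuery x i) (adj G)) (ρ G)
  incidenceQuery-represents = record
    { sound    = λ x i b c → canonical⇒ρ G ∘ incidence⇒canonical ∘ run⇒incidence x i
    ; complete = λ x b c h → let i , p , inc , same = canonical⇒incidence (ρ⇒canonical G h) in
                             i , p , incidence⇒run inc , same
    ; unique   = λ x i j p p′ h h′ → incidence-unique (run⇒incidence x i h) (run⇒incidence x j h′)
    }

sortPair : ∀ {N} → Fin N × Fin N → Fin N × Fin N
sortPair (a , a′) = if ⌊ a <? a′ ⌋ then (a , a′) else (a′ , a)

sortPair-samePair : ∀ {N} {p} {b c : Fin N} → SamePair p (b , c) → b < c → sortPair p ≡ (b , c)
sortPair-samePair {b = b} {c} (inj₁ (refl , refl)) b<c rewrite fromWitness≡ (b <? c) b<c = refl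
sortPair-samePair {b = b} {c} (inj₂ (refl , refl)) b<c
  rewrite fromWitnessFalse≡ (c <? b) (<-asym b<c) = refl

_≟₂_ : ∀ {N} → DecidableEquality (Fin N × Fin N)
_≟₂_ = ≡-dec _≟_ _≟_

∑∑-point : ∀ {N} (q : Fin N × Fin N) → ∑[ b < N ] ∑[ c < N ] 𝟙 ⌊ q ≟₂ (b , c) ⌋ ≡ 1
∑∑-point {N} q@(q₁ , q₂) = begin
  ∑[ b < N ] ∑[ c < N ] 𝟙 ⌊ q ≟₂ (b , c) ⌋  ≡⟨ ∑∑-single q₁ q₂ (λ b c bc≢q → miss (bc≢q ∘ sym)) ⟩
  𝟙 ⌊ q ≟₂ q ⌋                               ≡⟨ cong 𝟙 (fromWitness≡ (q ≟₂ q) refl) ⟩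
  1                                          ∎
  where
  open ≡-Reasoning
  miss : ∀ {p} → q ≢ p → 𝟙 ⌊ q ≟₂ p ⌋ ≡ 0
  miss {p} q≢p = cong 𝟙 (fromWitnessFalse≡ (q ≟₂ p) q≢p)

listedAs : ∀ {N} → Maybe (Fin N × Fin N) → Fin N → Fin N → ℕ
listedAs nothing  b c = 0
listedAs (just p) b c = 𝟙 ⌊ sortPair p ≟₂ (b , c) ⌋

∑∑-listedAs≤1 : ∀ {N} (m : Maybe (Fin N × Fin N)) → ∑[ b < N ] ∑[ c < N ] listedAs m b c ≤ 1
∑∑-listedAs≤1 {N} nothing = ℕ.≤-trans (ℕ.≤-reflexive (∑-zero {N} λ b → ∑-zero {N} λ c → refl)) z≤n
∑∑-listedAs≤1 (just p)    = ℕ.≤-reflexive (∑∑-point (sortPair p))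

listedAs-samePair : ∀ {N} {p} {b c : Fin N} → SamePair p (b , c) → b < c → listedAs (just p) b c ≡ 1
listedAs-samePair {p = p} {b} {c} same b<c rewrite sortPair-samePair same b<c =
  cong 𝟙 (fromWitness≡ ((b , c) ≟₂ (b , c)) refl)

-- Each pair b < c with E x b c is listed at some slot of x, and each slot lists at most one pair.
degree-bound : ∀ {N Δ} {inc : Fin N → Fin Δ → Maybe (Fin N × Fin N)} {E : HEdges N} →
               Represents inc E → ∀ x → degH E x ≤ Δ
degree-bound {N} {Δ} {inc} {E} R x = begin
  degH E x
    ≡⟨ sumFin²≡∑² N N _ ⟩
  ∑[ b < N ] ∑[ c < N ] 𝟙 (⌊ b <? c ⌋ ∧ E x b c)
    ≤⟨ ∑-mono-≤ (λ b → ∑-mono-≤ (λ c → edge≤listings b c)) ⟩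
  ∑[ b < N ] ∑[ c < N ] ∑[ i < Δ ] listedAs (inc x i) b c
    ≡⟨ sum-cong-≗ (λ b → ∑-comm (λ c i → listedAs (inc x i) b c)) ⟩
  ∑[ b < N ] ∑[ i < Δ ] ∑[ c < N ] listedAs (inc x i) b c
    ≡⟨ ∑-comm (λ b i → ∑[ c < N ] listedAs (inc x i) b c) ⟩
  ∑[ i < Δ ] ∑[ b < N ] ∑[ c < N ] listedAs (inc x i) b c
    ≤⟨ ∑-mono-≤ (λ i → ∑∑-listedAs≤1 (inc x i)) ⟩
  ∑[ i < Δ ] 1
    ≡⟨ ∑-one Δ ⟩
  Δ ∎
  where
  open ℕ.≤-Reasoning
  edge≤listings : ∀ b c → 𝟙 (⌊ b <? c ⌋ ∧ E x b c) ≤ ∑[ i < Δ ] listedAs (inc x i) b c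
  edge≤listings b c with b <? c | E x b c in edge
  ... | no _    | _     = z≤n
  ... | yes _   | false = z≤n
  ... | yes b<c | true with Represents.complete R x b c edge
  ...   | i , p , inc≡p , same = begin
    1                       ≡⟨ listedAs-samePair same b<c ⟨
    listedAs (just p) b c   ≡⟨ cong (λ m → listedAs m b c) inc≡p ⟨
    listedAs (inc x i) b c  ≤⟨ term≤∑ (λ i → listedAs (inc x i) b c) i ⟩
    ∑[ i < Δ ] listedAs (inc x i) b c ∎

-- Adjacency lists are gap-free, so deleting entries requires closing the gaps.
module _ {A : Set} where

  pad : List A → ∀ {d} → Fin d → Maybe A
  pad []       _       = nothing
  pad (a ∷ as) zero    = just a
  pad (a ∷ as) (suc i) = pad as i

  pad-gap-free : ∀ as {d} (i j : Fin d) → pad as i ≡ nothing → i < j → pad as j ≡ nothing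
  pad-gap-free []       i       j       _  _         = refl
  pad-gap-free (a ∷ as) (suc i) (suc j) eq (s≤s i<j) = pad-gap-free as i j eq i<j

  pad-∈ : ∀ as {d} (i : Fin d) {a} → pad as i ≡ just a → a ∈ as
  pad-∈ (b ∷ as) zero    refl = here refl
  pad-∈ (b ∷ as) (suc i) eq   = there (pad-∈ as i eq)

  ∈-pad : ∀ {as a d} → a ∈ as → length as ≤ d → ∃ λ (i : Fin d) → pad as i ≡ just a
  ∈-pad {d = suc d} (here refl) _          = zero , refl
  ∈-pad {d = suc d} (there a∈)  (s≤s len≤) = let i , eq = ∈-pad a∈ len≤ in suc i , eq

  pad-injective : ∀ {as} → Unique as → ∀ {d} (i j : Fin d) {a} →
                  pad as i ≡ just a → pad as j ≡ just a → i ≡ j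
  pad-injective (_   ∷ _)   zero    zero    _    _   = refl
  pad-injective (a≢ ∷ _)   zero    (suc j) refl eq  = contradiction refl (All.lookup a≢ (pad-∈ _ j eq))
  pad-injective (a≢ ∷ _)   (suc i) zero    eq   refl = contradiction refl (All.lookup a≢ (pad-∈ _ i eq))
  pad-injective (_   ∷ as!) (suc i) (suc j) eq   eq′ = cong suc (pad-injective as! i j eq eq′)

  entries : ∀ {d} → (Fin d → Maybe A) → List A
  entries {zero}  f = []
  entries {suc d} f = f zero ?∷ entries (f ∘ suc)

  length-entries : ∀ {d} (f : Fin d → Maybe A) → length (entries f) ≤ d
  length-entries {zero}  f = z≤n
  length-entries {suc d} f with f zero
  ... | just _  = s≤s (length-entries (f ∘ suc))
  ... | nothing = ℕ.m≤n⇒m≤1+n (length-entries (f ∘ suc))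

  ∈-entries⁻ : ∀ {d} (f : Fin d → Maybe A) {a} → a ∈ entries f → ∃ λ i → f i ≡ just a
  ∈-entries⁻ {suc d} f a∈ with f zero in eq
  ... | nothing = let i , e = ∈-entries⁻ (f ∘ suc) a∈ in suc i , e
  ... | just b with a∈
  ...   | here refl = zero , eq
  ...   | there a∈′ = let i , e = ∈-entries⁻ (f ∘ suc) a∈′ in suc i , e

  ∈-entries⁺ : ∀ {d} (f : Fin d → Maybe A) i {a} → f i ≡ just a → a ∈ entries f
  ∈-entries⁺ f zero eq with f zero
  ∈-entries⁺ f zero refl | just a = here refl
  ∈-entries⁺ f (suc i) eq with f zero
  ... | just _  = there (∈-entries⁺ (f ∘ suc) i eq)
  ... | nothing = ∈-entries⁺ (f ∘ suc) i eq

  entries-unique : ∀ {d} (f : Fin d → Maybe A) → (∀ {i j a} → f i ≡ just a → f j ≡ just a → i ≡ j) →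
                   Unique (entries f)
  entries-unique {zero}  f inj = []
  entries-unique {suc d} f inj with f zero in eq
  ... | nothing = entries-unique (f ∘ suc) (λ e e′ → suc-injective (inj e e′))
  ... | just a  = All.tabulate new ∷ entries-unique (f ∘ suc) (λ e e′ → suc-injective (inj e e′))
    where
    new : ∀ {b} → b ∈ entries (f ∘ suc) → a ≢ b
    new b∈ refl = let i , e = ∈-entries⁻ (f ∘ suc) b∈ in 0≢1+n (inj eq e)

  compact : ∀ {d} → (Fin d → Maybe A) → Fin d → Maybe A
  compact f = pad (entries f)

  module _ {d} (f : Fin d → Maybe A) where

    compact-gap-free : ∀ (i j : Fin d) → compact f i ≡ nothing → i < j → compact f j ≡ nothing
    compact-gap-free = pad-gap-free (entries f)

    compact-just⁻ : ∀ i {a} → compact f i ≡ just a → ∃ λ j → f j ≡ just a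
    compact-just⁻ i = ∈-entries⁻ f ∘ pad-∈ (entries f) i

    compact-just⁺ : ∀ j {a} → f j ≡ just a → ∃ λ i → compact f i ≡ just a
    compact-just⁺ j eq = ∈-pad (∈-entries⁺ f j eq) (length-entries f)

    compact-injective : (∀ {i j a} → f i ≡ just a → f j ≡ just a → i ≡ j) →
                        ∀ i j {a} → compact f i ≡ just a → compact f j ≡ just a → i ≡ j
    compact-injective inj = pad-injective (entries-unique f inj)

module _ {n d : ℕ} (G : Graph n d) {P : Fin n → Fin n → Set}
         (P? : ∀ u v → Dec (P u v)) (P-sym : ∀ {u v} → P u v → P v u) where

  private
    kept : Fin n → Fin d → Maybe (Fin n)
    kept u i = keep (P? u) (adj G u i)

    kept-just : ∀ {u i v} → kept u i ≡ just v → P u v × adj G u i ≡ just v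
    kept-just {u} {i} = keep-just (P? u) (adj G u i)

    kept-intro : ∀ {u i v} → adj G u i ≡ just v → P u v → kept u i ≡ just v
    kept-intro {u} eq p rewrite eq = keep-intro (P? u) p

    restricted-just⁻ : ∀ {u i v} → compact (kept u) i ≡ just v → Adj G u v × P u v
    restricted-just⁻ {u} {i} eq =
      let j , e = compact-just⁻ (kept u) i eq ; p , a = kept-just e in (j , a) , p

    restricted-just⁺ : ∀ {u v} → Adj G u v → P u v → ∃ λ i → compact (kept u) i ≡ just v
    restricted-just⁺ {u} (j , eq) p = compact-just⁺ (kept u) j (kept-intro eq p)

  restrict : Graph n d
  restrict = record
    { adj       = compact ∘ kept
    ; gap-free  = λ u → compact-gap-free (kept u)
    ; no-loop   = λ u i eq → let (j , a) , _ = restricted-just⁻ eq in no-loop G u j a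
    ; no-dup    = λ u i j v → compact-injective (kept u)
                    (λ e e′ → no-dup G u _ _ _ (proj₂ (kept-just e)) (proj₂ (kept-just e′))) i j
    ; symmetric = λ u i v eq → let (j , a) , p = restricted-just⁻ eq in
                    restricted-just⁺ (symmetric G u j v a) (P-sym p)
    }

  restrict-edge⁻ : ∀ {u v} → edgeB restrict u v ≡ true → Adj G u v × P u v
  restrict-edge⁻ = restricted-just⁻ ∘ proj₂ ∘ edgeB⇒Adj restrict

  restrict-edge⁺ : ∀ {u v} → Adj G u v → P u v → edgeB restrict u v ≡ true
  restrict-edge⁺ a p = Adj⇒edgeB restrict (restricted-just⁺ a p)

module Bichromatic {n d Δ : ℕ} (G : Graph n d) (H : Hypergraph (n + n * d) Δ) (χ : Vertex n d → Fin 3)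
                   (χ-rainbow : ∀ a b c → edges H a b c ≡ true → Rainbow χ a b c) where

  χᵒ : Fin n → Fin 3
  χᵒ u = χ (origV d u)

  bichromatic? : ∀ u v → Dec (χᵒ u ≢ χᵒ v)
  bichromatic? u v = ¬? (χᵒ u ≟ χᵒ v)

  bichromatic : Graph n d
  bichromatic = restrict G bichromatic? ≢-sym

  bichromatic-colourable : ThreeColorable bichromatic
  bichromatic-colourable = χᵒ , λ u v → proj₂ ∘ restrict-edge⁻ G bichromatic? ≢-sym

  bichromatic⊆G : ∀ {u v} → edgeB bichromatic u v ≡ true → edgeB G u v ≡ true
  bichromatic⊆G = Adj⇒edgeB G ∘ proj₁ ∘ restrict-edge⁻ G bichromatic? ≢-sym

  lost-edge⇒missing-hyperedge : ∀ {u v} → u < v → edgeB G u v ≡ true → edgeB bichromatic u v ≡ false →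
                                ∃ λ j → ρ G (origV d u) (origV d v) (auxV u j) ≡ true
                                      × edges H (origV d u) (origV d v) (auxV u j) ≡ false
  lost-edge⇒missing-hyperedge {u} {v} u<v inG notInB with edgeB⇒Adj G inG | χᵒ u ≟ χᵒ v
  ... | adjacent | no χu≢χv =
    contradiction (trans (sym (restrict-edge⁺ G bichromatic? ≢-sym adjacent χu≢χv)) notInB) λ ()
  ... | j , adj≡v | yes χu≡χv =
    j , canonical⇒ρ G (xyz (canonical (upNeighbour-intro G u<v adj≡v))) , notInH
    where
    notInH : edges H (origV d u) (origV d v) (auxV u j) ≡ false
    notInH with edges H (origV d u) (origV d v) (auxV u j) in inH
    ... | false = refl
    ... | true  = contradiction χu≡χv (proj₁ (χ-rainbow _ _ _ inH))

  N : ℕ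
  N = n + n * d

  mismatch : Vertex n d → Vertex n d → Vertex n d → ℕ
  mismatch a b c = 𝟙 (⌊ a <? b ⌋ ∧ ⌊ b <? c ⌋ ∧ (ρ G a b c xor edges H a b c))

  lost-edge≤mismatches : ∀ u v → 𝟙 (⌊ u <? v ⌋ ∧ (edgeB G u v xor edgeB bichromatic u v))
                                 ≤ ∑[ c < N ] mismatch (origV d u) (origV d v) c
  lost-edge≤mismatches u v with u <? v
  ... | no _ = z≤n
  ... | yes u<v with edgeB G u v in inG | edgeB bichromatic u v in inB
  ...   | false | false = z≤n
  ...   | true  | true  = z≤n
  ...   | false | true  = contradiction (trans (sym inG) (bichromatic⊆G inB)) λ ()
  ...   | true  | false with lost-edge⇒missing-hyperedge u<v inG inB
  ...     | j , inρ , notInH = begin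
    1                                            ≡⟨ hit ⟨
    mismatch (origV d u) (origV d v) (auxV u j)  ≤⟨ term≤∑ (mismatch (origV d u) (origV d v)) (auxV u j) ⟩
    ∑[ c < N ] mismatch (origV d u) (origV d v) c ∎
    where
    open ℕ.≤-Reasoning
    hit : mismatch (origV d u) (origV d v) (auxV u j) ≡ 1
    hit rewrite fromWitness≡ (origV d u <? origV d v) (origV-mono-< u<v)
              | fromWitness≡ (origV d v <? auxV u j) (origV<auxV v u j) | inρ | notInH = refl

  diff-bound : diffG (edgeB G) (edgeB bichromatic) ≤ diffH (ρ G) (edges H)
  diff-bound = begin
    diffG (edgeB G) (edgeB bichromatic)
      ≡⟨ sumFin²≡∑² n n _ ⟩
    ∑[ u < n ] ∑[ v < n ] 𝟙 (⌊ u <? v ⌋ ∧ (edgeB G u v xor edgeB bichromatic u v))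
      ≤⟨ ∑-mono-≤ (λ u → ∑-mono-≤ (lost-edge≤mismatches u)) ⟩
    ∑[ u < n ] ∑[ v < n ] ∑[ c < N ] mismatch (origV d u) (origV d v) c
      ≤⟨ ∑-mono-≤ (λ (u : Fin n) → ∑-↑ˡ-≤ n (n * d) (λ b → ∑[ c < N ] mismatch (origV d u) b c)) ⟩
    ∑[ u < n ] ∑[ b < N ] ∑[ c < N ] mismatch (origV d u) b c
      ≤⟨ ∑-↑ˡ-≤ n (n * d) (λ a → ∑[ b < N ] ∑[ c < N ] mismatch a b c) ⟩
    ∑[ a < N ] ∑[ b < N ] ∑[ c < N ] mismatch a b c
      ≡⟨ trans (sumFin≡∑ N _) (sum-cong-≗ (λ a → sumFin²≡∑² N N (mismatch a))) ⟨
    diffH (ρ G) (edges H) ∎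
    where open ℕ.≤-Reasoning

ℕ→ℚ≡mkℚ : ∀ k → ℕ→ℚ k ≡ mkℚ (ℤ.+ k) 0 (Coprime.sym (1-coprimeTo k))
ℕ→ℚ≡mkℚ k = ℚ.normalize-coprime (Coprime.sym (1-coprimeTo k))

ℕ→ℚ-* : ∀ a b → ℕ→ℚ (a * b) ≡ ℕ→ℚ a *ℚ ℕ→ℚ b
ℕ→ℚ-* a b = begin
  ℕ→ℚ (a * b)             ≡⟨ cong (_/ 1) (pos-* a b) ⟩
  (ℤ.+ a ℤ.* ℤ.+ b) / 1   ≡⟨ cong₂ _*ℚ_ (ℕ→ℚ≡mkℚ a) (ℕ→ℚ≡mkℚ b) ⟨
  ℕ→ℚ a *ℚ ℕ→ℚ b         ∎
  where open ≡-Reasoning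

ℕ→ℚ-mono-≤ : ∀ {a b} → a ≤ b → ℕ→ℚ a ≤ℚ ℕ→ℚ b
ℕ→ℚ-mono-≤ {a} {b} a≤b = subst₂ _≤ℚ_ (sym (ℕ→ℚ≡mkℚ a)) (sym (ℕ→ℚ≡mkℚ b))
  (ℚ.*≤* (*-monoʳ-≤-nonNeg (ℤ.+ 1) (ℤ.+≤+ a≤b)))

module _ (M : ℕ) .{{_ : ℕ.NonZero M}} where

  private instance
    ℕ→ℚ-positive : ℚ.Positive (ℕ→ℚ M)
    ℕ→ℚ-positive = ℚ.normalize-pos M 1

    ℕ→ℚ-nonZero : ℚ.NonZero (ℕ→ℚ M)
    ℕ→ℚ-nonZero = ℚ.pos⇒nonZero (ℕ→ℚ M)

  inverse : ℚ
  inverse = 1/ ℕ→ℚ M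

  inverse-positive : 0ℚ <ℚ inverse
  inverse-positive = ℚ.positive⁻¹ inverse {{ℚ.1/pos⇒pos (ℕ→ℚ M)}}

  inverse-cancel : ∀ n ε → (inverse *ℚ ε) *ℚ ℕ→ℚ (M * n) ≡ ε *ℚ ℕ→ℚ n
  inverse-cancel n ε = begin
    (inverse *ℚ ε) *ℚ ℕ→ℚ (M * n)        ≡⟨ cong₂ _*ℚ_ (ℚ.*-comm inverse ε) (ℕ→ℚ-* M n) ⟩
    (ε *ℚ inverse) *ℚ (ℕ→ℚ M *ℚ ℕ→ℚ n)  ≡⟨ ℚ.*-assoc ε inverse _ ⟩
    ε *ℚ (inverse *ℚ (ℕ→ℚ M *ℚ ℕ→ℚ n))  ≡⟨ cong (ε *ℚ_) (ℚ.*-assoc inverse (ℕ→ℚ M) (ℕ→ℚ n)) ⟨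
    ε *ℚ ((inverse *ℚ ℕ→ℚ M) *ℚ ℕ→ℚ n)  ≡⟨ cong (λ q → ε *ℚ (q *ℚ ℕ→ℚ n)) (ℚ.*-inverseˡ (ℕ→ℚ M)) ⟩
    ε *ℚ (1ℚ *ℚ ℕ→ℚ n)                   ≡⟨ cong (ε *ℚ_) (ℚ.*-identityˡ (ℕ→ℚ n)) ⟩
    ε *ℚ ℕ→ℚ n                            ∎
    where open ≡-Reasoning

ρ-vertices : ∀ d n → n + n * d ≡ suc d * n
ρ-vertices d n = cong (n +_) (ℕ.*-comm n d)

diffG-self : ∀ {n} (E : Fin n → Fin n → Bool) → diffG E E ≡ 0
diffG-self {n} E = trans (sumFin²≡∑² n n _) (∑-zero {n} λ u → ∑-zero {n} λ v → same u v)
  where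
  same : ∀ u v → 𝟙 (⌊ u <? v ⌋ ∧ (E u v xor E u v)) ≡ 0
  same u v rewrite xor-same (E u v) | ∧-zeroʳ ⌊ u <? v ⌋ = refl

degree-0-not-far : ∀ {n} (G : Graph n 0) ε → ¬ FarFrom3Col ε G
degree-0-not-far G ε far =
  ℚ.<-irrefl (trans (ℚ.*-zeroʳ ε) (cong ℕ→ℚ (sym (diffG-self (edgeB G)))))
             (far G ((λ _ → 0F) , λ u v ()))

gapConstant : ℕ → ℚ
gapConstant d = inverse (suc (d + d * d) * suc d)

gapConstant-positive : ∀ d → 0ℚ <ℚ gapConstant d
gapConstant-positive d = inverse-positive (suc (d + d * d) * suc d)

ρ-far : ∀ d {n} (G : Graph n d) {ε} → 0ℚ <ℚ ε → FarFrom3Col ε G →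
        FarFrom3Part (suc (d + d * d)) (gapConstant d *ℚ ε) (ρ G)
ρ-far zero          G {ε} _   far = contradiction far (degree-0-not-far G ε)
ρ-far d@(suc _) {n} G {ε} 0<ε far H (χ , χ-rainbow) = begin-strict
  (gapConstant d *ℚ ε) *ℚ ℕ→ℚ (Δ′ * (n + n * d))  ≡⟨ cong (λ k → (gapConstant d *ℚ ε) *ℚ ℕ→ℚ k) size ⟩
  (gapConstant d *ℚ ε) *ℚ ℕ→ℚ (M * n)            ≡⟨ inverse-cancel M n ε ⟩
  ε *ℚ ℕ→ℚ n                                      ≤⟨ ℚ.*-monoˡ-≤-nonNeg ε {{ε≥0}} (ℕ→ℚ-mono-≤ (ℕ.m≤n*m n d)) ⟩
  ε *ℚ ℕ→ℚ (d * n)                                <⟨ far bichromatic bichromatic-colourable ⟩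
  ℕ→ℚ (diffG (edgeB G) (edgeB bichromatic))       ≤⟨ ℕ→ℚ-mono-≤ diff-bound ⟩
  ℕ→ℚ (diffH (ρ G) (edges H))                     ∎
  where
  open ℚ.≤-Reasoning
  open Bichromatic G H χ χ-rainbow
  Δ′ M : ℕ
  Δ′ = suc (d + d * d)
  M  = Δ′ * suc d
  ε≥0 : ℚ.NonNegative ε
  ε≥0 = ℚ.nonNegative (ℚ.<⇒≤ 0<ε)
  size : Δ′ * (n + n * d) ≡ M * n
  size = trans (cong (Δ′ *_) (ρ-vertices d n)) (sym (ℕ.*-assoc Δ′ (suc d) n))

ρ-isHypergraph : ∀ {n d} (G : Graph n d) → IsHypergraph (suc (d + d * d)) (ρ G)
ρ-isHypergraph G = record
  { swap₁₂   = anyOrder-swap₁₂ (ρtriple G)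
  ; swap₂₃   = anyOrder-swap₂₃ (ρtriple G)
  ; distinct = ρ-distinct G
  ; degree   = degree-bound (incidenceQuery-represents G)
  }

lemma2 : (d : ℕ) →
    -- O(n) vertices
    (∃ λ (C : ℕ) → ∀ n → n + n * d ≤ C * n)
    × (Σ ℕ λ Δ′ →
      -- bounded degree (Δ′ depends only on d); ρ(G) is a 3-uniform hypergraph
      (∀ n (G : Graph n d) → IsHypergraph Δ′ (ρ G))
      -- locality: each incidence query to ρ(G) answered with ≤ q queries to G
      × (∃ λ (q : ℕ) →
          Σ ((n : ℕ) → Fin (n + n * d) → Fin Δ′ → QueryTree n d (Maybe (Fin (n + n * d) × Fin (n + n * d))))
            λ alg → (∀ n x i → AtMostQueries q (alg n x i))
                  × (∀ n (G : Graph n d) → Represents (λ x i → run (alg n x i) (adj G)) (ρ G)))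
      -- completeness
      × (∀ n (G : Graph n d) → ThreeColorable G → ThreePartite (ρ G))
      -- soundness (gap preservation)
      × (Σ ℚ λ c → 0ℚ <ℚ c
          × (∀ n (G : Graph n d) (ε : ℚ) → 0ℚ <ℚ ε →
               FarFrom3Col ε G → FarFrom3Part Δ′ (c *ℚ ε) (ρ G))))
lemma2 d =
    (suc d , λ n → ℕ.≤-reflexive (ρ-vertices d n))
  , suc (d + d * d)
  , (λ n → ρ-isHypergraph)
  , (2 , (λ n → Queries.incidenceQuery) , (λ n → Queries.incidenceQuery-queries)
       , λ n → incidenceQuery-represents)
  , (λ n → ρ-threePartite)
  , (gapConstant d , gapConstant-positive d , λ n G ε 0<ε → ρ-far d G 0<ε)
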